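{- Let $T$ be a tree with exactly one degree-$2$ vertex $v$, and let $T'$ be the HIT obtained from $T$ by smoothing $v$. Then \[b^{\{v\}}(T) \le b(T').\]
   Context: All graphs are finite, simple and connected. A HIT (homeomorphically irreducible tree) is a tree with no degree-$2$ vertices. Smoothing a degree-$2$ vertex $v$ with neighbours $a,b$ means deleting $v$ and adding the edge $ab$. Graph burning: given a graph $G$ and a sequence of vertices (sources) $S=(x_1,\ldots,x_k)$, all vertices are unburned in round $0$; in round $i\in\{1,\ldots,k\}$ the vertex $x_i$ is burned (if not already burned), together with every unburned vertex having a neighbour that was burned by round $i-1$. Burned vertices stay burned. $S$ is a burning sequence for $G$ if all vertices of $G$ are burned at the end of round $k$, and the burning number $b(G)$ is the length of a shortest burning sequence for $G$. Modified burning: for $U\subseteq V(G)$ and vertices $x_1,\ldots,x_k\in V(G)$, the sequence $M=(U\cup\{x_1\},x_2,\ldots,x_k)$ is processed by burning all vertices of $U\cup\{x_1\}$ in round $1$, and then proceeding in rounds $i\ge 2$ exactly as in ordinary burning. $M$ is a modified burning sequence for $G$ if all vertices of $G$ are burned at the end of round $k$. The modified burning number $b^{U}(G)$ is the length of a shortest modified burning sequence for $G$ with the given set $U$. -}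

module Defs where

open import Data.Nat using (ℕ; zero; suc; _≤_)
open import Data.Bool using (Bool; true; false; T; _∧_; _∨_; not)
open import Data.Fin using (Fin; punchIn; _≟_)
open import Data.List using (List; []; _∷_; length; filterᵇ; _++_; [_])
open import Data.List.Relation.Unary.Linked using (Linked)
open import Data.List.Relation.Unary.Unique.Propositional using (Unique)
open import Data.Product using (Σ; ∃; _×_)
open import Data.Sum using (_⊎_)
open import Data.Empty using (⊥)
open import Relation.Nullary.Decidable using (⌊_⌋)
open import Relation.Binary.PropositionalEquality using (_≡_)
open import Data.List.Base using () renaming (allFin to allFinL)

Graph : ℕ → Set
Graph m = Fin m → Fin m → Bool

Adj : ∀ {m} → Graph m → Fin m → Fin m → Set
Adj E x y = T (E x y)

IsSimple : ∀ {m} → Graph m → Set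
IsSimple E = (∀ x y → E x y ≡ E y x) × (∀ x → E x x ≡ false)

data Reach {m} (E : Graph m) (u : Fin m) : Fin m → Set where
  here : Reach E u u
  step : ∀ {w x} → Reach E u w → Adj E w x → Reach E u x

IsConnected : ∀ {m} → Graph m → Set
IsConnected E = ∀ u w → Reach E u w

IsCycle : ∀ {m} → Graph m → Fin m → List (Fin m) → Set
IsCycle E x xs = (2 ≤ length xs) × Unique (x ∷ xs) × Linked (Adj E) (x ∷ xs ++ [ x ])

IsAcyclic : ∀ {m} → Graph m → Set
IsAcyclic E = ∀ x xs → IsCycle E x xs → ⊥

IsTree : ∀ {m} → Graph m → Set
IsTree E = IsSimple E × IsConnected E × IsAcyclic E

degree : ∀ {m} → Graph m → Fin m → ℕ
degree {m} E v = length (filterᵇ (E v) (allFinL m))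

-- Smoothing the vertex v of a graph on Fin (suc n): the new vertex set is
-- Fin n, embedded into Fin (suc n) \ {v} via punchIn v. Two vertices are
-- adjacent iff they were adjacent before, or they are distinct and both
-- adjacent to v. (When v has degree 2 with neighbours a, b this is exactly
-- "delete v and add the edge ab".)
smooth : ∀ {n} → Graph (suc n) → Fin (suc n) → Graph n
smooth E v x y =
  E (punchIn v x) (punchIn v y)
  ∨ (E v (punchIn v x) ∧ E v (punchIn v y) ∧ not ⌊ x ≟ y ⌋)

-- Burning with an initial set U of vertices burned in round 1
-- (U = ∅ gives ordinary burning).
-- Src xs i u : the (i+1)-st source of xs is u (i.e. u = x_{i+1}).
Src : ∀ {m} → List (Fin m) → ℕ → Fin m → Set
Src [] i u = ⊥
Src (x ∷ xs) zero u = x ≡ u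
Src (x ∷ xs) (suc i) u = Src xs i u

Burned : ∀ {m} → Graph m → (Fin m → Set) → List (Fin m) → ℕ → Fin m → Set
Burned E U xs zero u = ⊥
Burned E U xs (suc i) u =
  Burned E U xs i u
  ⊎ (i ≡ zero × U u)
  ⊎ Src xs i u
  ⊎ Σ _ (λ w → Adj E w u × Burned E U xs i w)

NoVertex : ∀ {m} → Fin m → Set
NoVertex _ = ⊥

IsBurningSeq : ∀ {m} → Graph m → List (Fin m) → Set
IsBurningSeq E xs = ∀ u → Burned E NoVertex xs (length xs) u

-- modified burning sequence (U ∪ {x₁}, x₂, …, x_k), given as U and (x₁,…,x_k)
IsModBurningSeq : ∀ {m} → Graph m → (Fin m → Set) → List (Fin m) → Set
IsModBurningSeq E U xs = (1 ≤ length xs) × (∀ u → Burned E U xs (length xs) u)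

IsBurningNumber : ∀ {m} → Graph m → ℕ → Set
IsBurningNumber E k =
  Σ (List _) (λ xs → length xs ≡ k × IsBurningSeq E xs)
  × (∀ xs → IsBurningSeq E xs → k ≤ length xs)

IsModBurningNumber : ∀ {m} → Graph m → (Fin m → Set) → ℕ → Set
IsModBurningNumber E U k =
  Σ (List _) (λ xs → length xs ≡ k × IsModBurningSeq E U xs)
  × (∀ xs → IsModBurningSeq E U xs → k ≤ length xs)

-- Map a burning sequence of T' into T along the vertex embedding punchIn v.
-- A fire crossing the new edge ab of T' is matched in T by the fire spreading
-- from v, which is already burned in round 1; so the image is a modified
-- burning sequence of the same length. Only the existence of a second vertex
-- (so that burning sequences of T' are nonempty) uses the hypotheses on T.
module Submission where

open import Defs
open import Data.Nat using (ℕ; zero; suc; _≤_; s≤s; z≤n)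
open import Data.Fin using (Fin; punchIn; punchOut; _≟_)
open import Data.Fin.Properties using (punchIn-punchOut)
open import Data.List using ([]; _∷_; length; map)
open import Data.List.Properties using (length-map)
open import Data.Bool using (false)
open import Data.Bool.Properties using (T-∨; T-∧)
open import Data.Product using (_,_; proj₁; proj₂)
open import Data.Sum using (_⊎_; inj₁; inj₂)
open import Data.Empty using (⊥-elim)
open import Function.Bundles using (Equivalence)
open import Relation.Nullary using (yes; no)
open import Relation.Binary.PropositionalEquality using (_≡_; refl; subst)

Src-map : ∀ {m m′} (f : Fin m → Fin m′) xs i u → Src xs i u → Src (map f xs) i (f u)
Src-map f (x ∷ xs) zero    u refl = refl
Src-map f (x ∷ xs) (suc i) u s    = Src-map f xs i u s

Burned-initial : ∀ {m} (E : Graph m) (U : Fin m → Set) xs i {u} → U u → Burned E U xs (suc i) u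
Burned-initial E U xs zero    Uu = inj₂ (inj₁ (refl , Uu))
Burned-initial E U xs (suc i) Uu = inj₁ (Burned-initial E U xs i Uu)

loopless-singleton-degree : (E : Graph 1) → E Fin.zero Fin.zero ≡ false → degree E Fin.zero ≡ 0
loopless-singleton-degree E noLoop rewrite noLoop = refl

module _ {n : ℕ} (E : Graph (suc n)) (v : Fin (suc n)) where

  smooth-adj : ∀ {x y} → Adj (smooth E v) x y → Adj E (punchIn v x) (punchIn v y) ⊎ Adj E v (punchIn v y)
  smooth-adj {x} {y} adj with Equivalence.to T-∨ adj
  ... | inj₁ direct = inj₁ direct
  ... | inj₂ viaV   =
    inj₂ (proj₁ (Equivalence.to (T-∧ {E v (punchIn v y)})
                   (proj₂ (Equivalence.to (T-∧ {E v (punchIn v x)}) viaV))))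

  Burned-smooth⇒Burned : ∀ xs i u → Burned (smooth E v) NoVertex xs i u →
                         Burned E (_≡ v) (map (punchIn v) xs) i (punchIn v u)
  Burned-smooth⇒Burned xs (suc i) u (inj₁ earlier) = inj₁ (Burned-smooth⇒Burned xs i u earlier)
  Burned-smooth⇒Burned xs (suc i) u (inj₂ (inj₂ (inj₁ src))) =
    inj₂ (inj₂ (inj₁ (Src-map (punchIn v) xs i u src)))
  Burned-smooth⇒Burned xs (suc (suc i)) u (inj₂ (inj₂ (inj₂ (w , adj , burntW)))) with smooth-adj adj
  ... | inj₁ direct = inj₂ (inj₂ (inj₂ (punchIn v w , direct , Burned-smooth⇒Burned xs (suc i) w burntW)))
  ... | inj₂ fromV  = inj₂ (inj₂ (inj₂ (v , fromV , Burned-initial E (_≡ v) _ i refl)))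

  IsBurningSeq-smooth⇒IsModBurningSeq : ∀ x xs → IsBurningSeq (smooth E v) (x ∷ xs) →
                                        IsModBurningSeq E (_≡ v) (map (punchIn v) (x ∷ xs))
  IsBurningSeq-smooth⇒IsModBurningSeq x xs burnt = s≤s z≤n , burntAll
    where
    burntAll : ∀ u → Burned E (_≡ v) (map (punchIn v) (x ∷ xs)) (length (map (punchIn v) (x ∷ xs))) u
    burntAll u rewrite length-map (punchIn v) xs with v ≟ u
    ... | yes refl = Burned-initial E (_≡ v) _ (length xs) refl
    ... | no v≢u   = subst (Burned E (_≡ v) _ _) (punchIn-punchOut v≢u)
                       (Burned-smooth⇒Burned (x ∷ xs) _ (punchOut v≢u) (burnt (punchOut v≢u)))

lemma2p3 : (n : ℕ) (E : Graph (suc n)) (v : Fin (suc n)) →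
    IsTree E →
    degree E v ≡ 2 →
    (∀ u → degree E u ≡ 2 → u ≡ v) →
    (k m : ℕ) →
    IsBurningNumber (smooth E v) k →
    IsModBurningNumber E (_≡ v) m →
    m ≤ k
lemma2p3 zero E Fin.zero ((_ , noLoops) , _) deg2 _ _ _ _ _
  with () ← subst (_≡ 2) (loopless-singleton-degree E (noLoops Fin.zero)) deg2
lemma2p3 (suc n) E v _ _ _ _ _ (([] , _ , burning) , _) _ = ⊥-elim (burning Fin.zero)
lemma2p3 (suc n) E v _ _ _ _ m ((x ∷ xs , refl , burning) , _) (_ , minimal) =
  subst (m ≤_) (length-map (punchIn v) (x ∷ xs))
    (minimal (map (punchIn v) (x ∷ xs)) (IsBurningSeq-smooth⇒IsModBurningSeq E v x xs burning))
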